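{- Let $p\ge 3$ and let $T$ be a tree with color classes $A$ and $B$, $a=|A|\le |B|$, such that $T$ has a leaf in $A$ and $\alpha(T)=|B|$. Then for every $n$ (for which the graph is defined), $H(n,p,a)$ does not contain $T^{p+1}$ as a subgraph.
   Context: All graphs are finite, simple, undirected. $\alpha(T)$ is the independence number. For a graph $H$, the blow-up $H^{p+1}$ is obtained by replacing each edge of $H$ by a clique $K_{p+1}$ containing that edge, with the new vertices for different edges all distinct. $T_{n,p}$ is the complete $p$-partite graph on $n$ vertices with class sizes as equal as possible, and $H(n,p,s)=K_{s-1}\bigotimes T_{n-s+1,p}$, where $X\bigotimes Y$ is the join of vertex-disjoint graphs (disjoint union plus all edges between them). -}

module Defs where

open import Data.Nat using (ℕ; zero; suc; _≤_; _<_; _∸_; _<?_)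
open import Data.Nat.DivMod using (_%_)
open import Data.Bool using (Bool; true; false; _∧_; _∨_; not)
open import Data.Fin using (Fin; toℕ; _≟_)
open import Data.Fin.Subset using (Subset; _∈_; _∉_; ∣_∣; ∁)
open import Data.List using (List; []; _∷_; length; _∷ʳ_)
open import Data.List.Relation.Unary.Unique.Propositional using (Unique)
open import Data.List.Relation.Unary.Linked using (Linked)
open import Data.Sum using (_⊎_; inj₁; inj₂)
open import Data.Product using (Σ; _×_; _,_; ∃)
open import Function.Definitions using (Injective)
open import Relation.Binary.PropositionalEquality using (_≡_; _≢_)
open import Relation.Nullary using (¬_)
open import Relation.Nullary.Decidable using (⌊_⌋)

Graph : Set → Set
Graph V = V → V → Bool

Adj : ∀ {V} → Graph V → V → V → Set
Adj G u v = G u v ≡ true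

IsSimple : ∀ {V} → Graph V → Set
IsSimple G = (∀ u v → G u v ≡ G v u) × (∀ v → G v v ≡ false)

data Walk {V : Set} (G : Graph V) : V → V → Set where
  here : ∀ {v} → Walk G v v
  step : ∀ {u w v} → Adj G u w → Walk G w v → Walk G u v

Connected : ∀ {V} → Graph V → Set
Connected {V} G = ∀ (u v : V) → Walk G u v

IsCycle : ∀ {V} → Graph V → List V → Set
IsCycle G [] = ⊥'
  where open import Data.Empty using () renaming (⊥ to ⊥')
IsCycle G (x ∷ xs) = (3 ≤ length (x ∷ xs)) × Unique (x ∷ xs) × Linked (Adj G) ((x ∷ xs) ∷ʳ x)

Acyclic : ∀ {V} → Graph V → Set
Acyclic {V} G = ∀ (c : List V) → ¬ IsCycle G c

IsTree : ∀ {k} → Graph (Fin k) → Set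
IsTree {k} G = (1 ≤ k) × IsSimple G × Connected G × Acyclic G

-- A is one colour class of a proper 2-colouring, the other being ∁ A
IsBipartition : ∀ {k} → Graph (Fin k) → Subset k → Set
IsBipartition {k} G A = ∀ (u v : Fin k) → Adj G u v →
  (u ∈ A × v ∉ A) ⊎ (u ∉ A × v ∈ A)

nbhd : ∀ {k} → Graph (Fin k) → Fin k → Subset k
nbhd G u = Data.Vec.tabulate (G u)
  where import Data.Vec

degree : ∀ {k} → Graph (Fin k) → Fin k → ℕ
degree G u = ∣ nbhd G u ∣

IsIndependent : ∀ {k} → Graph (Fin k) → Subset k → Set
IsIndependent {k} G S = ∀ (u v : Fin k) → u ∈ S → v ∈ S → ¬ Adj G u v

IsIndependenceNumber : ∀ {k} → Graph (Fin k) → ℕ → Set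
IsIndependenceNumber {k} G m =
  (Σ (Subset k) λ S → IsIndependent G S × ∣ S ∣ ≡ m) ×
  (∀ (S : Subset k) → IsIndependent G S → ∣ S ∣ ≤ m)

-- Blow-up G^{p+1}: each edge {i,j} (i<j) gets p-1 new vertices, forming
-- a clique K_{p+1} together with i and j.
EdgeOf : ∀ {k} → Graph (Fin k) → Set
EdgeOf {k} G = Σ (Fin k × Fin k) λ { (i , j) → (toℕ i < toℕ j) × Adj G i j }

BlowV : ∀ {k} → Graph (Fin k) → ℕ → Set
BlowV {k} G p = Fin k ⊎ (EdgeOf G × Fin (p ∸ 1))

blowUp : ∀ {k} (G : Graph (Fin k)) (p : ℕ) → Graph (BlowV G p)
blowUp G p (inj₁ u) (inj₁ v) = G u v
blowUp G p (inj₁ u) (inj₂ (((i , j) , _) , _)) = ⌊ u ≟ i ⌋ ∨ ⌊ u ≟ j ⌋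
blowUp G p (inj₂ (((i , j) , _) , _)) (inj₁ u) = ⌊ u ≟ i ⌋ ∨ ⌊ u ≟ j ⌋
blowUp G p (inj₂ (((i , j) , _) , t)) (inj₂ (((i' , j') , _) , t')) =
  ⌊ i ≟ i' ⌋ ∧ ⌊ j ≟ j' ⌋ ∧ not ⌊ t ≟ t' ⌋

partClass : ℕ → ℕ → ℕ
partClass zero m = m
partClass (suc q) m = m % suc q

-- H(n,p,s) = K_{s-1} ⊗ T_{n-s+1,p} on vertex set Fin n: vertices with
-- index < s-1 form the clique; the remaining vertex with index s-1+m
-- lies in Turán class m mod p (class sizes as equal as possible).
Hgraph : (n p s : ℕ) → Graph (Fin n)
Hgraph n p s i j =
  not ⌊ i ≟ j ⌋ ∧
  (⌊ toℕ i <? (s ∸ 1) ⌋ ∨ ⌊ toℕ j <? (s ∸ 1) ⌋ ∨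
   not ⌊ partClass p (toℕ i ∸ (s ∸ 1)) Data.Nat.≟ partClass p (toℕ j ∸ (s ∸ 1)) ⌋)
  where import Data.Nat

Contains : ∀ {V W} → Graph W → Graph V → Set
Contains {V} {W} H G = Σ (V → W) λ f → Injective _≡_ _≡_ f ×
  (∀ u v → Adj G u v → Adj H (f u) (f v))

module Submission where

-- Suppose f embeds the blow-up T^{p+1} into H = H(n,p,a),
-- whose "core" K_{a-1} consists of the vertices of index < a - 1.
--   * Outside the core H is p-partite, so every (p+1)-clique of H meets
--     the core; in particular, for every edge ij of T the clique K_{p+1}
--     built on ij in T^{p+1} has a vertex mapped into the core.
--   * Call a vertex v of T charged if f v lies in the core, or v has a
--     neighbour j of larger index with f j outside the core.  For such an
--     edge vj the core vertex of its clique is v itself or one of the new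
--     vertices of vj, so each charged v owns a blow-up vertex mapped into
--     the core.  Owners are distinct and f is injective, hence at most
--     a - 1 < a vertices are charged.
--   * The uncharged vertices are independent in T, and there are more
--     than k - a = |B| of them, contradicting α(T) = |B|.

open import Defs
open import Data.Nat using (ℕ; zero; suc; _≤_; _<_; _∸_; _<?_; z≤n; s≤s)
import Data.Nat as ℕ
open import Data.Nat.Properties using (<-cmp; ∸-monoʳ-<; <⇒≱; <-irrefl; n<1+n)
open import Data.Nat.DivMod using (m%n<n)
open import Data.Fin using (Fin; toℕ; fromℕ<; punchOut; _≟_) renaming (zero to fzero; suc to fsuc)
open import Data.Fin.Properties using (toℕ-injective; fromℕ<-injective; pigeonhole; punchOut-injective; suc-injective; any?)
open import Data.Fin.Subset using (Subset; _∈_; ∣_∣; ∁; inside; outside)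
open import Data.Fin.Subset.Properties using (∣p∣≤n; x∈∁p⇒x∉p; ∣∁p∣≡n∸∣p∣; ∣⁅x⁆∣≡1; x∈⁅y⁆⇒x≡y; p⊆q⇒∣p∣≤∣q∣)
open import Data.Vec using (_∷_; []; tabulate; here; there)
open import Data.Vec.Properties using ([]=⇒lookup; lookup⇒[]=; lookup∘tabulate)
open import Data.Bool using (Bool; true; false; not; _∧_; _∨_)
import Data.Bool as Bool
open import Data.Bool.Properties using (∨-zeroʳ; ∧-zeroʳ)
open import Data.Product using (Σ; _×_; _,_; proj₁; proj₂; ∃)
open import Data.Sum using (_⊎_; inj₁; inj₂)
open import Data.Empty using (⊥-elim)
open import Function.Definitions using (Injective)
open import Relation.Binary.PropositionalEquality using (_≡_; _≢_; refl; sym; trans; cong; cong₂; subst; subst₂; module ≡-Reasoning)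
open import Relation.Binary.Definitions using (tri<; tri≈; tri>)
open import Relation.Nullary using (¬_; Dec; yes; no)
open import Relation.Nullary.Decidable using (⌊_⌋; isYes≗does; dec-true; dec-false; _×-dec_; _⊎-dec_; ¬?)

∣p∣≤-injection : ∀ {k m} (p : Subset k) (ψ : ∀ v → v ∈ p → Fin m) →
  (∀ {u v} pu pv → ψ u pu ≡ ψ v pv → u ≡ v) → ∣ p ∣ ≤ m
∣p∣≤-injection [] ψ ψ-inj = z≤n
∣p∣≤-injection (outside ∷ p) ψ ψ-inj =
  ∣p∣≤-injection p (λ v pv → ψ (fsuc v) (there pv))
    (λ pu pv eq → suc-injective (ψ-inj (there pu) (there pv) eq))
∣p∣≤-injection {m = zero} (inside ∷ p) ψ ψ-inj with ψ fzero here
... | ()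
∣p∣≤-injection {m = suc m} (inside ∷ p) ψ ψ-inj =
  s≤s (∣p∣≤-injection p ψ′ ψ′-inj)
  where
  -- the image of the first element is avoided by all the others,
  -- so removing it ("punching it out") leaves an injection into Fin m
  avoids : ∀ v pv → ψ fzero here ≢ ψ (fsuc v) (there pv)
  avoids v pv eq with ψ-inj here (there pv) eq
  ... | ()
  ψ′ : ∀ v → v ∈ p → Fin m
  ψ′ v pv = punchOut (avoids v pv)
  ψ′-inj : ∀ {u v} pu pv → ψ′ u pu ≡ ψ′ v pv → u ≡ v
  ψ′-inj pu pv eq =
    suc-injective (ψ-inj (there pu) (there pv) (punchOut-injective (avoids _ pu) (avoids _ pv) eq))

∈-tabulate⁺ : ∀ {k} (χ : Fin k → Bool) v → χ v ≡ true → v ∈ tabulate χ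
∈-tabulate⁺ χ v eq = lookup⇒[]= v (tabulate χ) (trans (lookup∘tabulate χ v) eq)

∈-tabulate⁻ : ∀ {k} (χ : Fin k → Bool) v → v ∈ tabulate χ → χ v ≡ true
∈-tabulate⁻ χ v pv = trans (sym (lookup∘tabulate χ v)) ([]=⇒lookup pv)

⌊⌋-yes : ∀ {P : Set} (d : Dec P) → P → ⌊ d ⌋ ≡ true
⌊⌋-yes d x = trans (isYes≗does d) (dec-true d x)

⌊⌋-no : ∀ {P : Set} (d : Dec P) → ¬ P → ⌊ d ⌋ ≡ false
⌊⌋-no d ¬x = trans (isYes≗does d) (dec-false d ¬x)

∈⇒1≤∣p∣ : ∀ {k} {x : Fin k} (p : Subset k) → x ∈ p → 1 ≤ ∣ p ∣
∈⇒1≤∣p∣ {x = x} p x∈p =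
  subst (_≤ ∣ p ∣) (∣⁅x⁆∣≡1 x)
    (p⊆q⇒∣p∣≤∣q∣ (λ y∈⁅x⁆ → subst (_∈ p) (sym (x∈⁅y⁆⇒x≡y x y∈⁅x⁆)) x∈p))

module Hgraph-Structure (n q s : ℕ) where

  H : Graph (Fin n)
  H = Hgraph n (suc q) s

  InCore : Fin n → Set
  InCore w = toℕ w < s ∸ 1

  turánClass : Fin n → Fin (suc q)
  turánClass w = fromℕ< (m%n<n (toℕ w ∸ (s ∸ 1)) (suc q))

  outsideCore-adjacent⇒classes-differ : ∀ a b → ¬ InCore a → ¬ InCore b →
    Adj H a b → turánClass a ≢ turánClass b
  outsideCore-adjacent⇒classes-differ a b a∉ b∉ adj same = false≢true (trans (sym (∧-zeroʳ _)) adj′)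
    where
    false≢true : false ≢ true
    false≢true ()
    sameIndex : partClass (suc q) (toℕ a ∸ (s ∸ 1)) ≡ partClass (suc q) (toℕ b ∸ (s ∸ 1))
    sameIndex = fromℕ<-injective _ _ _ _ same
    noClause : (⌊ toℕ a <? s ∸ 1 ⌋ ∨ ⌊ toℕ b <? s ∸ 1 ⌋ ∨
                not ⌊ partClass (suc q) (toℕ a ∸ (s ∸ 1)) ℕ.≟ partClass (suc q) (toℕ b ∸ (s ∸ 1)) ⌋)
               ≡ false
    noClause = cong₂ _∨_ (⌊⌋-no (toℕ a <? s ∸ 1) a∉)
                 (cong₂ _∨_ (⌊⌋-no (toℕ b <? s ∸ 1) b∉) (cong not (⌊⌋-yes (_ ℕ.≟ _) sameIndex)))
    adj′ : not ⌊ a ≟ b ⌋ ∧ false ≡ true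
    adj′ = subst (λ c → not ⌊ a ≟ b ⌋ ∧ c ≡ true) noClause adj

  -- Every (p+1)-clique of H meets the core: by pigeonhole two of its
  -- p + 1 vertices share a Turán class, so not all avoid the core.
  clique-meets-core : (g : Fin (suc (suc q)) → Fin n) →
    (∀ x y → x ≢ y → Adj H (g x) (g y)) → ∃ λ x → InCore (g x)
  clique-meets-core g clique with any? (λ x → toℕ (g x) <? s ∸ 1)
  ... | yes found = found
  ... | no none
    with x , y , x<y , same ← pigeonhole (n<1+n (suc q)) (λ x → turánClass (g x)) =
    ⊥-elim (outsideCore-adjacent⇒classes-differ (g x) (g y)
      (λ h → none (x , h)) (λ h → none (y , h)) (clique x y x≢y) same)
    where
    x≢y : x ≢ y
    x≢y refl = <-irrefl refl x<y

module BlowUp-Cliques {k} (T : Graph (Fin k)) (symmetric : ∀ u v → T u v ≡ T v u) (q : ℕ) where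

  edgeClique : EdgeOf T → Fin (suc (suc q)) → BlowV T (suc q)
  edgeClique (((i , j) , _)) fzero = inj₁ i
  edgeClique (((i , j) , _)) (fsuc fzero) = inj₁ j
  edgeClique e (fsuc (fsuc t)) = inj₂ (e , t)

  edgeClique-complete : ∀ e x y → x ≢ y →
    Adj (blowUp T (suc q)) (edgeClique e x) (edgeClique e y)
  edgeClique-complete e fzero fzero x≢y = ⊥-elim (x≢y refl)
  edgeClique-complete e (fsuc fzero) (fsuc fzero) x≢y = ⊥-elim (x≢y refl)
  edgeClique-complete ((i , j) , _ , ij) fzero (fsuc fzero) _ = ij
  edgeClique-complete ((i , j) , _ , ij) (fsuc fzero) fzero _ = trans (symmetric j i) ij
  edgeClique-complete ((i , j) , _) fzero (fsuc (fsuc t)) _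
    rewrite ⌊⌋-yes (i ≟ i) refl = refl
  edgeClique-complete ((i , j) , _) (fsuc fzero) (fsuc (fsuc t)) _
    rewrite ⌊⌋-yes (j ≟ j) refl = ∨-zeroʳ _
  edgeClique-complete ((i , j) , _) (fsuc (fsuc t)) fzero _
    rewrite ⌊⌋-yes (i ≟ i) refl = refl
  edgeClique-complete ((i , j) , _) (fsuc (fsuc t)) (fsuc fzero) _
    rewrite ⌊⌋-yes (j ≟ j) refl = ∨-zeroʳ _
  edgeClique-complete ((i , j) , _) (fsuc (fsuc t)) (fsuc (fsuc t′)) x≢y
    rewrite ⌊⌋-yes (i ≟ i) refl | ⌊⌋-yes (j ≟ j) refl
          | ⌊⌋-no (t ≟ t′) (λ { refl → x≢y refl }) = refl

module Charging {k} (T : Graph (Fin k)) (simple : IsSimple T) (n q s : ℕ)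
  (f : BlowV T (suc q) → Fin n)
  (hom : ∀ u v → Adj (blowUp T (suc q)) u v → Adj (Hgraph n (suc q) s) (f u) (f v)) where

  open Hgraph-Structure n q s
  open BlowUp-Cliques T (proj₁ simple) q

  edge-touches-core : ∀ (e : EdgeOf T) →
    InCore (f (edgeClique e fzero)) ⊎ InCore (f (edgeClique e (fsuc fzero))) ⊎
    (∃ λ t → InCore (f (inj₂ (e , t))))
  edge-touches-core e
    with clique-meets-core (λ x → f (edgeClique e x))
           (λ x y x≢y → hom _ _ (edgeClique-complete e x y x≢y))
  ... | fzero , h = inj₁ h
  ... | fsuc fzero , h = inj₂ (inj₁ h)
  ... | fsuc (fsuc t) , h = inj₂ (inj₂ (t , h))

  owner : BlowV T (suc q) → Fin k
  owner (inj₁ v) = v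
  owner (inj₂ (((i , _) , _) , _)) = i

  UpwardEscape : Fin k → Fin k → Set
  UpwardEscape v j = (toℕ v < toℕ j) × Adj T v j × ¬ InCore (f (inj₁ j))

  Charged : Fin k → Set
  Charged v = InCore (f (inj₁ v)) ⊎ (∃ λ j → UpwardEscape v j)

  charged? : ∀ v → Dec (Charged v)
  charged? v = (toℕ (f (inj₁ v)) <? s ∸ 1) ⊎-dec
    any? (λ j → (toℕ v <? toℕ j) ×-dec (T v j Bool.≟ true) ×-dec ¬? (toℕ (f (inj₁ j)) <? s ∸ 1))

  charge : ∀ v → Charged v → Σ (BlowV T (suc q)) λ x → InCore (f x) × owner x ≡ v
  charge v (inj₁ h) = inj₁ v , h , refl
  charge v (inj₂ (j , v<j , vj , j∉)) with edge-touches-core ((v , j) , v<j , vj)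
  ... | inj₁ h = inj₁ v , h , refl
  ... | inj₂ (inj₁ h) = ⊥-elim (j∉ h)
  ... | inj₂ (inj₂ (t , h)) = inj₂ (((v , j) , v<j , vj) , t) , h , refl

  charged : Subset k
  charged = tabulate (λ v → ⌊ charged? v ⌋)

  ∈charged⇒Charged : ∀ v → v ∈ charged → Charged v
  ∈charged⇒Charged v pv with charged? v | ∈-tabulate⁻ _ v pv
  ... | yes c | _ = c
  ... | no _ | ()

  ∈∁charged⇒¬Charged : ∀ v → v ∈ ∁ charged → ¬ Charged v
  ∈∁charged⇒¬Charged v pv c = x∈∁p⇒x∉p pv (∈-tabulate⁺ _ v (⌊⌋-yes (charged? v) c))

  -- Injectivity of f makes the charges distinct core vertices: at most s - 1 are charged.
  ∣charged∣≤core : Injective _≡_ _≡_ f → ∣ charged ∣ ≤ s ∸ 1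
  ∣charged∣≤core f-inj = ∣p∣≤-injection charged coreVertex coreVertex-inj
    where
    chargeOf : ∀ v → v ∈ charged → Σ (BlowV T (suc q)) λ x → InCore (f x) × owner x ≡ v
    chargeOf v pv = charge v (∈charged⇒Charged v pv)
    coreVertex : ∀ v → v ∈ charged → Fin (s ∸ 1)
    coreVertex v pv = fromℕ< (proj₁ (proj₂ (chargeOf v pv)))
    coreVertex-inj : ∀ {u v} pu pv → coreVertex u pu ≡ coreVertex v pv → u ≡ v
    coreVertex-inj {u} {v} pu pv eq = begin
      u                             ≡⟨ sym (proj₂ (proj₂ (chargeOf u pu))) ⟩
      owner (proj₁ (chargeOf u pu)) ≡⟨ cong owner (f-inj (toℕ-injective (fromℕ<-injective _ _ _ _ eq))) ⟩
      owner (proj₁ (chargeOf v pv)) ≡⟨ proj₂ (proj₂ (chargeOf v pv)) ⟩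
      v                             ∎
      where open ≡-Reasoning

  -- No edge joins two uncharged vertices: its lower end would be charged.
  uncharged-independent : IsIndependent T (∁ charged)
  uncharged-independent u v pu pv uv with <-cmp (toℕ u) (toℕ v)
  ... | tri< u<v _ _ =
    ∈∁charged⇒¬Charged u pu (inj₂ (v , u<v , uv , λ h → ∈∁charged⇒¬Charged v pv (inj₁ h)))
  ... | tri≈ _ u≡v _ with refl ← toℕ-injective u≡v
    with () ← trans (sym (proj₂ simple u)) uv
  uncharged-independent u v pu pv uv | tri> _ _ v<u =
    ∈∁charged⇒¬Charged v pv
      (inj₂ (u , v<u , trans (proj₁ simple v u) uv , λ h → ∈∁charged⇒¬Charged u pu (inj₁ h)))

proposition1 : (p : ℕ) → 3 ≤ p →
    (k : ℕ) (T : Graph (Fin k)) → IsTree T →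
    (A : Subset k) → IsBipartition T A →
    ∣ A ∣ ≤ ∣ ∁ A ∣ →
    (Σ (Fin k) λ v → v ∈ A × degree T v ≡ 1) →
    IsIndependenceNumber T ∣ ∁ A ∣ →
    (n : ℕ) → ∣ A ∣ ∸ 1 ≤ n →
    ¬ Contains (Hgraph n p ∣ A ∣) (blowUp T p)
proposition1 (suc q) _ k T (_ , simple , _) A _ _ (w , w∈A , _) (_ , α-maximum) n _ (f , f-inj , hom) =
  <⇒≱ more-uncharged (α-maximum (∁ charged) uncharged-independent)
  where
  open Charging T simple n q ∣ A ∣ f hom
  -- a ≥ 1 because A contains a leaf, and at most a - 1 vertices are charged
  fewer-charged : ∣ charged ∣ < ∣ A ∣
  fewer-charged with ∣ A ∣ | ∈⇒1≤∣p∣ A w∈A | ∣charged∣≤core f-inj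
  ... | suc _ | s≤s _ | bound = s≤s bound
  -- hence the uncharged vertices outnumber B = ∁ A, against α(T) = |B|
  more-uncharged : ∣ ∁ A ∣ < ∣ ∁ charged ∣
  more-uncharged = subst₂ _<_ (sym (∣∁p∣≡n∸∣p∣ A)) (sym (∣∁p∣≡n∸∣p∣ charged))
    (∸-monoʳ-< fewer-charged (∣p∣≤n A))
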